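{- Let $G=(V,E)$ be a temporal graph, $s\in V$, $t_s$ real. During the temporal BFS of $G$ from $s$ starting at $t_s$, apart from the initial record of $s$, at most $|E(t_s)|$ records are pushed into the queue $Q$.
   Context: A temporal graph is $G=(V,E)$ with $V$ a finite vertex set and $E$ a finite set of temporal edges $(u,v,t)$, $u\neq v$, $t$ real; distinct temporal edges from $u$ to $v$ have distinct times. $E(t_s)=\{(u,v,t)\in E: t\ge t_s\}$. BFS from $s$ with starting time $t_s$: keep $\sigma(x)$ (time most recently assigned to $x$), initially $\infty$; FIFO queue $Q$ of records $(x,d,\tau,p)$ (vertex, hop count, time, predecessor). Set $\sigma(s)=t_s$, push the initial record $(s,0,t_s,\text{none})$. While $Q\neq\emptyset$: pop $(u,d_u,\tau_u,p_u)$; for each out-neighbor $v$ of $u$ with $E_{u,v}\neq\emptyset$, where $E_{u,v}$ is the set of not-yet-traversed edges $(u,v,t)\in E$ with $\tau_u\le t$, traverse the edge $(u,v,t)$ of $E_{u,v}$ of minimum time; then (i) if $Q$ has no record of $v$: if $\sigma(v)>t$, set $\sigma(v)=t$ and push $(v,d_u+1,t,\text{popped record})$; (ii) else if $Q$ has a record of $v$ with hop count $d_u+1$: if $\sigma(v)>t$, set $\sigma(v)=t$ and set that record's time to $t$ and predecessor to the popped record; (iii) else (the record of $v$ in $Q$ has hop count $d_u$): if $\sigma(v)>t$, set $\sigma(v)=t$ and push $(v,d_u+1,t,\text{popped record})$. -}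

module Defs where

open import Data.Nat using (ℕ; zero; suc)
open import Data.Fin using (Fin) renaming (_≟_ to _≟ᶠ_)
open import Data.List using (List; []; _∷_; _++_; [_])
open import Data.List.Relation.Unary.Any using (Any; here; there)
open import Data.List.Relation.Unary.All using (All)
open import Data.List.Relation.Unary.Unique.Propositional using (Unique)
open import Data.List.Membership.Propositional using (_∈_; _∉_)
open import Data.Maybe using (Maybe; just; nothing)
open import Data.Product using (_×_; _,_)
open import Data.Sum using (_⊎_)
open import Data.Unit using (⊤)
open import Data.Bool using (if_then_else_)
open import Relation.Nullary using (¬_; Dec)
open import Relation.Nullary.Decidable using (⌊_⌋; _⊎-dec_)
open import Relation.Binary.PropositionalEquality using (_≡_; _≢_)
open import Relation.Binary.Structures using (IsStrictTotalOrder)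
open import Relation.Binary.Construct.Closure.ReflexiveTransitive using (Star)

record TEdge (n : ℕ) (T : Set) : Set where
  constructor tedge
  field
    src  : Fin n
    tgt  : Fin n
    time : T
open TEdge public

-- Since E is a set of triples, distinct edges from u to v have distinct times.
record TemporalGraph (n : ℕ) (T : Set) : Set where
  field
    E        : List (TEdge n T)
    noLoops  : All (λ e → src e ≢ tgt e) E
    isSet    : Unique E
open TemporalGraph public

updateAt : {A : Set} {P : A → Set} {xs : List A} → Any P xs → (A → A) → List A
updateAt {xs = x ∷ xs} (here _)  f = f x ∷ xs
updateAt {xs = x ∷ xs} (there p) f = x ∷ updateAt p f

-- Times are elements of an arbitrary strict total order (e.g. the reals).
module BFS {T : Set} {_<_ : T → T → Set}
           (sto : IsStrictTotalOrder {A = T} _≡_ _<_)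
           {n : ℕ} (G : TemporalGraph n T) (s : Fin n) (tₛ : T) where

  open IsStrictTotalOrder sto using (_<?_; _≟_)

  _≤_ : T → T → Set
  a ≤ b = (a < b) ⊎ (a ≡ b)

  _≤?_ : (a b : T) → Dec (a ≤ b)
  a ≤? b = (a <? b) ⊎-dec (a ≟ b)

  -- |E(tₛ)| is  length (filter (λ e → tₛ ≤? time e) (E G)).

  -- σ-values: nothing = ∞.
  _<∞_ : T → Maybe T → Set
  t <∞ nothing = ⊤
  t <∞ just x  = t < x

  -- Queue records (x , d , τ , p); each record carries a unique identifier
  -- so that the predecessor p can refer to a record (nothing = none).
  record Rec : Set where
    constructor mkRec
    field
      rid  : ℕ
      vtx  : Fin n
      hop  : ℕ
      tm   : T
      pred : Maybe ℕ
  open Rec public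

  record State : Set where
    constructor mkState
    field
      queue  : List Rec
      σ      : Fin n → Maybe T
      trav   : List (TEdge n T)
      cur    : Maybe (Rec × List (Fin n)) -- popped record being processed,
                                          -- with out-neighbours already handled
      pushed : ℕ                          -- pushes after the initial record
  open State public

  setσ : (Fin n → Maybe T) → Fin n → T → Fin n → Maybe T
  setσ f v t w = if ⌊ w ≟ᶠ v ⌋ then just t else f w

  initRec : Rec
  initRec = mkRec 0 s 0 tₛ nothing

  initState : State
  initState = mkState [ initRec ] (setσ (λ _ → nothing) s tₛ) [] nothing 0

  Avail : List (TEdge n T) → Fin n → T → Fin n → TEdge n T → Set
  Avail tr u τ v e = e ∈ E G × src e ≡ u × tgt e ≡ v × τ ≤ time e × e ∉ tr

  MinAvail : List (TEdge n T) → Fin n → T → Fin n → TEdge n T → Set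
  MinAvail tr u τ v e = Avail tr u τ v e × (∀ e' → Avail tr u τ v e' → time e ≤ time e')

  newRec : State → Rec → Fin n → T → Rec
  newRec S r v t = mkRec (suc (pushed S)) v (suc (hop r)) t (just (rid r))

  HasRec : List Rec → Fin n → Set
  HasRec q v = Any (λ x → vtx x ≡ v) q

  HasRecHop : List Rec → Fin n → ℕ → Set
  HasRecHop q v d = Any (λ x → vtx x ≡ v × hop x ≡ d) q

  -- One step of the BFS. The order in which the out-neighbours of the
  -- popped vertex are handled is arbitrary (any order is allowed).
  data Step : State → State → Set where
    pop : ∀ r q σ tr k →
          Step (mkState (r ∷ q) σ tr nothing k) (mkState q σ tr (just (r , [])) k)
    finish : ∀ q σ tr r h k →
          (∀ v → v ∉ h → ∀ e → ¬ Avail tr (vtx r) (tm r) v e) →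
          Step (mkState q σ tr (just (r , h)) k) (mkState q σ tr nothing k)
    caseI-push : ∀ q σ tr r h k v e →
          v ∉ h → MinAvail tr (vtx r) (tm r) v e →
          ¬ HasRec q v → time e <∞ σ v →
          Step (mkState q σ tr (just (r , h)) k)
               (mkState (q ++ [ newRec (mkState q σ tr (just (r , h)) k) r v (time e) ])
                        (setσ σ v (time e)) (e ∷ tr) (just (r , v ∷ h)) (suc k))
    caseI-skip : ∀ q σ tr r h k v e →
          v ∉ h → MinAvail tr (vtx r) (tm r) v e →
          ¬ HasRec q v → ¬ (time e <∞ σ v) →
          Step (mkState q σ tr (just (r , h)) k)
               (mkState q σ (e ∷ tr) (just (r , v ∷ h)) k)
    caseII-upd : ∀ q σ tr r h k v e →
          v ∉ h → MinAvail tr (vtx r) (tm r) v e →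
          (p : HasRecHop q v (suc (hop r))) → time e <∞ σ v →
          Step (mkState q σ tr (just (r , h)) k)
               (mkState (updateAt p (λ x → mkRec (rid x) (vtx x) (hop x) (time e) (just (rid r))))
                        (setσ σ v (time e)) (e ∷ tr) (just (r , v ∷ h)) k)
    caseII-skip : ∀ q σ tr r h k v e →
          v ∉ h → MinAvail tr (vtx r) (tm r) v e →
          HasRecHop q v (suc (hop r)) → ¬ (time e <∞ σ v) →
          Step (mkState q σ tr (just (r , h)) k)
               (mkState q σ (e ∷ tr) (just (r , v ∷ h)) k)
    caseIII-push : ∀ q σ tr r h k v e →
          v ∉ h → MinAvail tr (vtx r) (tm r) v e →
          HasRec q v → ¬ HasRecHop q v (suc (hop r)) → time e <∞ σ v →
          Step (mkState q σ tr (just (r , h)) k)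
               (mkState (q ++ [ newRec (mkState q σ tr (just (r , h)) k) r v (time e) ])
                        (setσ σ v (time e)) (e ∷ tr) (just (r , v ∷ h)) (suc k))
    caseIII-skip : ∀ q σ tr r h k v e →
          v ∉ h → MinAvail tr (vtx r) (tm r) v e →
          HasRec q v → ¬ HasRecHop q v (suc (hop r)) → ¬ (time e <∞ σ v) →
          Step (mkState q σ tr (just (r , h)) k)
               (mkState q σ (e ∷ tr) (just (r , v ∷ h)) k)

  Reachable : State → Set
  Reachable S = Star Step initState S

module Submission where

-- Every push into the queue happens in a step that
-- also traverses an edge, and a traversed edge e leaves the popped record
-- u (whose time is ≥ tₛ) with  time u ≤ time e ; hence every traversed
-- edge belongs to E(tₛ).  An edge is only traversed if it was not traversed
-- before, so the list of traversed edges is duplicate-free.  Thus on every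
-- reachable state
--     pushed  ≤  #traversed edges  ≤  |E(tₛ)| .

open import Defs
open import Data.Nat using (ℕ; _≤_; suc; z≤n; s≤s)
open import Data.Nat.Properties using (≤-refl; ≤-trans; n≤1+n; module ≤-Reasoning)
open import Data.Fin using (Fin)
open import Data.List using (List; []; _∷_; length; filter)
open import Data.List.Properties using (length-removeAt′)
open import Data.List.Relation.Unary.Any using (Any; here; there; index; _─_)
open import Data.List.Relation.Unary.All as All using (All; []; _∷_)
open import Data.List.Relation.Unary.All.Properties using (++⁺; ¬Any⇒All¬)
open import Data.List.Relation.Unary.Unique.Propositional using (Unique)
open import Data.List.Relation.Unary.AllPairs using ([]; _∷_)
open import Data.List.Membership.Propositional using (_∈_)
open import Data.List.Membership.Propositional.Properties using (∈-filter⁺)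
open import Data.List.Relation.Binary.Subset.Propositional using (_⊆_)
open import Data.Maybe using (just)
import Data.Maybe.Relation.Unary.All as Maybe
open import Data.Product using (_×_; _,_; proj₁)
open import Data.Sum using (inj₂)
open import Data.Empty using (⊥-elim)
open import Function using (_∘_; id)
open import Relation.Binary.PropositionalEquality using (_≡_; _≢_; refl; sym)
open import Relation.Binary.Structures using (IsStrictTotalOrder)
import Relation.Binary.Construct.StrictToNonStrict as StrictToNonStrict
open import Relation.Binary.Construct.Closure.ReflexiveTransitive using (Star; ε; _◅_)

module _ {A : Set} where

  ∈-─ : ∀ {x y} {ys : List A} (x∈ys : x ∈ ys) → y ∈ ys → x ≢ y → y ∈ (ys ─ x∈ys)
  ∈-─ (here refl) (here refl) x≢y = ⊥-elim (x≢y refl)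
  ∈-─ (here _)    (there y∈ys) _   = y∈ys
  ∈-─ (there _)   (here refl)  _   = here refl
  ∈-─ (there x∈ys) (there y∈ys) x≢y = there (∈-─ x∈ys y∈ys x≢y)

  unique-⊆-length : ∀ {xs ys : List A} → Unique xs → xs ⊆ ys → length xs ≤ length ys
  unique-⊆-length {[]}     _                 _      = z≤n
  unique-⊆-length {x ∷ xs} {ys} (x∉xs ∷ xs!) xs⊆ys = begin
      suc (length xs)          ≤⟨ s≤s (unique-⊆-length xs! xs⊆ys─x) ⟩
      suc (length (ys ─ x∈ys)) ≡⟨ sym (length-removeAt′ ys (index x∈ys)) ⟩
      length ys                ∎
    where
    open ≤-Reasoning
    x∈ys : x ∈ ys
    x∈ys = xs⊆ys (here refl)
    xs⊆ys─x : xs ⊆ (ys ─ x∈ys)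
    xs⊆ys─x z∈xs = ∈-─ x∈ys (xs⊆ys (there z∈xs)) (All.lookup x∉xs z∈xs)

  all-updateAt : ∀ {P Q : A → Set} {xs : List A} (p : Any Q xs) {f : A → A} →
                 (∀ {x} → P x → P (f x)) → All P xs → All P (updateAt p f)
  all-updateAt (here _)  pf (px ∷ pxs) = pf px ∷ pxs
  all-updateAt (there p) pf (px ∷ pxs) = px ∷ all-updateAt p pf pxs

module PushBound {T : Set} {_<_ : T → T → Set} (sto : IsStrictTotalOrder {A = T} _≡_ _<_)
                 {n : ℕ} (G : TemporalGraph n T) (s : Fin n) (tₛ : T) where
  open BFS sto G s tₛ renaming (_≤_ to _≤ₜ_)
  open IsStrictTotalOrder sto using (isEquivalence; <-resp-≈; trans)

  ≤ₜ-trans : ∀ {a b c} → a ≤ₜ b → b ≤ₜ c → a ≤ₜ c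
  ≤ₜ-trans = StrictToNonStrict.trans _≡_ _<_ isEquivalence <-resp-≈ trans

  InEₜₛ : TEdge n T → Set
  InEₜₛ e = e ∈ E G × tₛ ≤ₜ time e

  Late : Rec → Set
  Late r = tₛ ≤ₜ tm r

  record Invariant (S : State) : Set where
    field
      pushes≤traversals : pushed S ≤ length (trav S)
      traversals-unique : Unique (trav S)
      traversals-in-Eₜₛ : All InEₜₛ (trav S)
      queue-late        : All Late (queue S)
      current-late      : Maybe.All (Late ∘ proj₁) (cur S)
  open Invariant

  initial : Invariant initState
  initial = record
    { pushes≤traversals = z≤n ; traversals-unique = [] ; traversals-in-Eₜₛ = []
    ; queue-late = inj₂ refl ∷ [] ; current-late = Maybe.nothing }

  -- Traversing an available edge from the popped record r, possibly pushing
  -- or updating one record with the edge's time, preserves the invariant: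
  -- the edge is new, lies in E(tₛ) since tₛ ≤ tm r ≤ time e, and at most one
  -- push happens.
  traversal : ∀ {q q' σ σ' tr r h v e k k'} →
              MinAvail tr (vtx r) (tm r) v e → k' ≤ suc k →
              (tₛ ≤ₜ time e → All Late q → All Late q') →
              Invariant (mkState q σ tr (just (r , h)) k) →
              Invariant (mkState q' σ' (e ∷ tr) (just (r , v ∷ h)) k')
  traversal {tr = tr} ((e∈E , _ , _ , τ≤t , e∉tr) , _) k'≤1+k queue-step I
    with current-late I
  ... | Maybe.just tₛ≤τ = record
    { pushes≤traversals = ≤-trans k'≤1+k (s≤s (pushes≤traversals I))
    ; traversals-unique = ¬Any⇒All¬ tr e∉tr ∷ traversals-unique I
    ; traversals-in-Eₜₛ = (e∈E , tₛ≤t) ∷ traversals-in-Eₜₛ I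
    ; queue-late        = queue-step tₛ≤t (queue-late I)
    ; current-late      = Maybe.just tₛ≤τ }
    where tₛ≤t = ≤ₜ-trans tₛ≤τ τ≤t

  step : ∀ {S S'} → Step S S' → Invariant S → Invariant S'
  step (pop r q σ tr k) I with queue-late I
  ... | r-late ∷ q-late = record
    { pushes≤traversals = pushes≤traversals I ; traversals-unique = traversals-unique I
    ; traversals-in-Eₜₛ = traversals-in-Eₜₛ I
    ; queue-late = q-late ; current-late = Maybe.just r-late }
  step (finish q σ tr r h k _) I = record
    { pushes≤traversals = pushes≤traversals I ; traversals-unique = traversals-unique I
    ; traversals-in-Eₜₛ = traversals-in-Eₜₛ I
    ; queue-late = queue-late I ; current-late = Maybe.nothing }
  step (caseI-push q σ tr r h k v e _ m _ _) =
    traversal m ≤-refl (λ tₛ≤t q-late → ++⁺ q-late (tₛ≤t ∷ []))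
  step (caseI-skip q σ tr r h k v e _ m _ _) = traversal m (n≤1+n k) (λ _ → id)
  step (caseII-upd q σ tr r h k v e _ m p _) =
    traversal m (n≤1+n k) (λ tₛ≤t → all-updateAt p (λ _ → tₛ≤t))
  step (caseII-skip q σ tr r h k v e _ m _ _) = traversal m (n≤1+n k) (λ _ → id)
  step (caseIII-push q σ tr r h k v e _ m _ _ _) =
    traversal m ≤-refl (λ tₛ≤t q-late → ++⁺ q-late (tₛ≤t ∷ []))
  step (caseIII-skip q σ tr r h k v e _ m _ _ _) = traversal m (n≤1+n k) (λ _ → id)

  reachable : ∀ {S} → Reachable S → Invariant S
  reachable = go initial
    where
    go : ∀ {S S'} → Invariant S → Star Step S S' → Invariant S'
    go I ε        = I
    go I (x ◅ xs) = go (step x I) xs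

  traversals⊆Eₜₛ : ∀ {S} → Invariant S → trav S ⊆ filter (λ e → tₛ ≤? time e) (E G)
  traversals⊆Eₜₛ I e∈tr with All.lookup (traversals-in-Eₜₛ I) e∈tr
  ... | e∈E , tₛ≤t = ∈-filter⁺ (λ e → tₛ ≤? time e) e∈E tₛ≤t

  pushes-bounded : ∀ S → Reachable S → pushed S ≤ length (filter (λ e → tₛ ≤? time e) (E G))
  pushes-bounded S R = ≤-trans (pushes≤traversals I)
                               (unique-⊆-length (traversals-unique I) (traversals⊆Eₜₛ I))
    where I = reachable R

lemma14 : {T : Set} {_<_ : T → T → Set} (sto : IsStrictTotalOrder {A = T} _≡_ _<_)
          {n : ℕ} (G : TemporalGraph n T) (s : Fin n) (tₛ : T)
          (S : BFS.State sto G s tₛ) → BFS.Reachable sto G s tₛ S →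
          BFS.State.pushed S ≤ length (filter (λ e → BFS._≤?_ sto G s tₛ tₛ (TEdge.time e)) (E G))
lemma14 sto G s tₛ = PushBound.pushes-bounded sto G s tₛ
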